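{- Let $H$ be a digraph (possibly with loops), $D$ an $H$-colored digraph, $\mathscr{F}$ an $H$-class partition of $A(D)$, $\mathcal{S}$ a non-empty subset of $\mathscr{F}$ such that $D\langle F\rangle$ is unilateral for every $F\in\mathcal{S}$, $K$ a kernel by walks in $D\langle\bigcup_{F\in\mathcal{S}}F\rangle$, and $\{x,z\}\subseteq K$ (with $x\ne z$). If $x\in V(D\langle F_1\rangle)$ and $z\in V(D\langle F_2\rangle)$ for some $F_1,F_2\in\mathcal{S}$, then $F_1\neq F_2$.
   Context: An $H$-colored digraph is a finite digraph $D$ without loops with a coloring $\rho:A(D)\to V(H)$. For $F\subseteq A(D)$, $D\langle F\rangle$ is the digraph with arc set $F$ and vertex set the vertices incident with an arc of $F$. An $H$-class partition of $A(D)$ is a partition $\mathscr{F}$ of $A(D)$ such that for all arcs $(u,v),(v,w)$ of $D$, $(\rho(u,v),\rho(v,w))\in A(H)$ iff some $F\in\mathscr{F}$ contains both arcs. A digraph is unilateral if any two vertices $u,v$ have a $uv$-path or a $vu$-path. A kernel by walks (equivalently, by paths) in a digraph is a vertex set $K$ with no walk between two different vertices of $K$ and such that every vertex not in $K$ has a walk to some vertex of $K$. -}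

module Defs where

open import Data.Nat using (ℕ)
open import Data.Fin using (Fin)
open import Data.Bool using (Bool; true)
open import Data.Product using (Σ; ∃; _×_; _,_)
open import Data.Sum using (_⊎_)
open import Relation.Nullary using (¬_)
open import Relation.Binary.PropositionalEquality using (_≡_; _≢_)
open import Relation.Binary.Construct.Closure.ReflexiveTransitive using (Star)

ArcSet : ℕ → Set₁
ArcSet n = Fin n → Fin n → Set

record Digraph (n : ℕ) : Set where
  field
    adj      : Fin n → Fin n → Bool
    loopless : ∀ u → ¬ (adj u u ≡ true)
open Digraph public

Arc : ∀ {n} → Digraph n → ArcSet n
Arc D u v = adj D u v ≡ true

Walk : ∀ {n} → ArcSet n → ArcSet n
Walk F = Star F

-- Vertex set of D⟨F⟩: vertices incident with an arc of F.
InV : ∀ {n} → ArcSet n → Fin n → Set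
InV F x = ∃ λ y → F x y ⊎ F y x

Unilateral : ∀ {n} → ArcSet n → Set
Unilateral F = ∀ u v → InV F u → InV F v → Walk F u v ⊎ Walk F v u

KernelByWalks : ∀ {n} → ArcSet n → (Fin n → Set) → Set
KernelByWalks F K =
  (∀ x → K x → InV F x) ×
  (∀ x y → K x → K y → x ≢ y → ¬ Walk F x y) ×
  (∀ x → InV F x → ¬ K x → ∃ λ y → K y × Walk F x y)

-- The class partition is encoded by a labelling cls of arcs by class
-- names Fin k; class i is the set of arcs labelled i.
ClassArcs : ∀ {n k} → Digraph n → (Fin n → Fin n → Fin k) → Fin k → ArcSet n
ClassArcs D cls i u v = Arc D u v × cls u v ≡ i

UnionArcs : ∀ {n k} → Digraph n → (Fin n → Fin n → Fin k) → (Fin k → Set) → ArcSet n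
UnionArcs D cls S u v = ∃ λ i → S i × ClassArcs D cls i u v

-- cls is an H-class partition of A(D) w.r.t. the colouring ρ:
-- every class is non-empty (genuine partition blocks), and for all arcs
-- (u,v),(v,w): (ρ(u,v),ρ(v,w)) ∈ A(H) iff both arcs lie in the same class.
IsHClassPartition : ∀ {m n k} → (Fin m → Fin m → Bool) → (D : Digraph n) →
                    (Fin n → Fin n → Fin m) → (Fin n → Fin n → Fin k) → Set
IsHClassPartition H D ρ cls =
  (∀ i → ∃ λ u → ∃ λ v → ClassArcs D cls i u v) ×
  (∀ u v w → Arc D u v → Arc D v w →
     (H (ρ u v) (ρ v w) ≡ true → cls u v ≡ cls v w) ×
     (cls u v ≡ cls v w → H (ρ u v) (ρ v w) ≡ true))

{-# OPTIONS --safe #-}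
module Submission where

open import Defs
open import Data.Fin using (Fin)
open import Data.Bool using (Bool)
open import Data.Product using (∃; _×_; _,_)
open import Data.Sum using (inj₁; inj₂)
open import Relation.Nullary using (¬_)
open import Relation.Binary.PropositionalEquality using (_≢_; refl; ≢-sym)
import Relation.Binary.Construct.Closure.ReflexiveTransitive as Star

kernel-not-in-unilateral : ∀ {n} {F G : ArcSet n} {K : Fin n → Set} →
                           (∀ {u v} → F u v → G u v) → Unilateral F →
                           KernelByWalks G K →
                           ∀ {x z} → K x → K z → x ≢ z →
                           ¬ (InV F x × InV F z)
kernel-not-in-unilateral F⊆G uni (_ , independent , _) {x} {z} Kx Kz x≢z (ix , iz)
  with uni x z ix iz
... | inj₁ x⇝z = independent x z Kx Kz x≢z (Star.map F⊆G x⇝z)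
... | inj₂ z⇝x = independent z x Kz Kx (≢-sym x≢z) (Star.map F⊆G z⇝x)

lemma8 : ∀ {m n k} (H : Fin m → Fin m → Bool) (D : Digraph n)
             (ρ : Fin n → Fin n → Fin m) (cls : Fin n → Fin n → Fin k) →
             IsHClassPartition H D ρ cls →
             (S : Fin k → Set) → ∃ S →
             (∀ i → S i → Unilateral (ClassArcs D cls i)) →
             (K : Fin n → Set) → KernelByWalks (UnionArcs D cls S) K →
             (x z : Fin n) → K x → K z → x ≢ z →
             (F₁ F₂ : Fin k) → S F₁ → S F₂ →
             InV (ClassArcs D cls F₁) x → InV (ClassArcs D cls F₂) z →
             F₁ ≢ F₂
lemma8 H D ρ cls _ S _ unilateral K kernel x z Kx Kz x≢z F .F sF _ ix iz refl =
  kernel-not-in-unilateral (λ a → F , sF , a) (unilateral F sF) kernel Kx Kz x≢z (ix , iz)
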